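{- For any integer $n\ge 5$, $\operatorname{adim}_2(C_n)=\left\lceil\frac{n}{2}\right\rceil$, $\operatorname{adim}_3(C_n)=n-\left\lfloor\frac{n}{5}\right\rfloor$ and $\operatorname{adim}_4(C_n)=n$.
   Context: $C_n$ is the cycle on $n$ vertices. For a graph $G=(V,E)$, $d_{G,2}(x,y)=\min\{d_G(x,y),2\}$ with $d_G$ the shortest-path distance. For distinct $x,y$, $\mathcal{C}_G(x,y)=\{z\in V: d_{G,2}(x,z)\ne d_{G,2}(y,z)\}$. A set $S\subseteq V$ is a $k$-adjacency generator if $|S\cap\mathcal{C}_G(x,y)|\ge k$ for all distinct $x,y$; $\operatorname{adim}_k(G)$ is the minimum cardinality of such a set. -}

module Defs where

open import Data.Nat using (ℕ; zero; suc; _+_; _≤_; _<_)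
open import Data.Nat.DivMod using (_%_)
open import Data.Bool using (Bool; true; false; _∨_; if_then_else_)
open import Data.Fin using (Fin; toℕ; _≟_)
open import Data.Fin.Subset using (Subset; _∩_; ∣_∣; ⁅_⁆)
open import Data.Vec using (tabulate)
open import Data.Product using (Σ; _×_)
open import Relation.Binary.PropositionalEquality using (_≡_; _≢_)
open import Relation.Nullary.Decidable using (⌊_⌋)
open import Data.Nat.Properties using () renaming (_≟_ to _≟ℕ_)

-- A graph on vertex set Fin n, given by its Boolean adjacency relation
-- (only x ≠ y pairs are ever consulted; the cycle below is symmetric).
Graph : ℕ → Set
Graph n = Fin n → Fin n → Bool

-- d_{G,2}(x,y) = min{d_G(x,y), 2}: 0 if x = y, 1 if adjacent, 2 otherwise.
d₂ : ∀ {n} → Graph n → Fin n → Fin n → ℕ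
d₂ G x y = if ⌊ x ≟ y ⌋ then 0 else (if G x y then 1 else 2)

distinguishers : ∀ {n} → Graph n → Fin n → Fin n → Subset n
distinguishers G x y = tabulate λ z → if ⌊ d₂ G x z ≟ℕ d₂ G y z ⌋ then false else true

IsKAdjGenerator : ∀ {n} → ℕ → Graph n → Subset n → Set
IsKAdjGenerator k G S = ∀ x y → x ≢ y → k ≤ ∣ S ∩ distinguishers G x y ∣

AdimIs : ∀ {n} → ℕ → Graph n → ℕ → Set
AdimIs k G m =
  Σ (Subset _) (λ S → IsKAdjGenerator k G S × ∣ S ∣ ≡ m)
  × (∀ S → IsKAdjGenerator k G S → m ≤ ∣ S ∣)

cycle : (n : ℕ) → Graph n
cycle zero ()
cycle n@(suc m) i j =
  ⌊ toℕ j ≟ℕ (suc (toℕ i)) % n ⌋ ∨ ⌊ toℕ i ≟ℕ (suc (toℕ j)) % n ⌋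

-- Number the vertices of C_n by Fin n and let prev be the cyclic predecessor. For distinct
-- x, y the set 𝒞(x, y) contains {next x, x, y, prev y} when y is prev x or prev² x (up to
-- swapping x and y), and the six vertices of the two closed neighbourhoods otherwise. So S
-- is a k-adjacency generator as soon as it meets each of these lists k times, which holds
-- for the even-indexed vertices (k = 2), for the complement of every fifth vertex (k = 3)
-- and for all vertices (k = 4).
-- Conversely 𝒞(prev a, prev² a) = {a, …, prev³ a} and 𝒞(prev a, prev³ a) = {a, prev a,
-- prev³ a, prev⁴ a}, so a k-generator meets these windows k times. Summing over all a,
-- every vertex is counted once per position in the window: 2n ≤ 4|S| for k = 2, and since
-- three such windows force four hits among five consecutive vertices, 4n ≤ 5|S| for k = 3.
-- For k = 4 the windows lie inside S.
module Submission where

open import Defs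
open import Data.Nat
  using ( ℕ; zero; suc; _+_; _*_; _∸_; _/_; _%_; _≤_; _<_; z≤n; s≤s; NonZero; >-nonZero
        ; ⌊_/2⌋; ⌈_/2⌉ )
open import Data.Nat.Properties
  using ( ≤-trans; ≤-reflexive; ≤-antisym; ≤-pred; n≤1+n; m≤m+n; m≤n+m; m≤n+m∸n; <⇒≢; <⇒≱
        ; n≤0⇒n≡0; +-comm; +-assoc; +-suc; +-identityʳ; +-cancelˡ-≡; +-cancelʳ-≤; +-mono-≤
        ; +-monoʳ-≤; +-monoʳ-<; *-comm; *-suc; *-distribʳ-∸; *-cancelʳ-≤; ∸-monoʳ-≤; m+n∸n≡m
        ; m≤n+o⇒m∸n≤o; ⌈n/2⌉-mono; n≡⌈n+n/2⌉; +-0-commutativeMonoid; module ≤-Reasoning )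
  renaming (_≟_ to _≟ℕ_; _≤?_ to _≤ℕ?_)
open import Data.Nat.DivMod using (n%n≡0; m<n⇒m%n≡m; n/n≡1; +-distrib-/-∣ˡ; m*n/n≡m; /-monoˡ-≤)
open import Data.Nat.Divisibility using (_∣_; ∣-refl; _∣0; ∣m∣n⇒∣m+n; ∣m+n∣m⇒∣n; ∣⇒≤)
open import Data.Nat.Tactic.RingSolver using (solve-∀)
open import Data.Bool using (true; false; not; _∨_; if_then_else_)
open import Data.Bool.Properties using (∨-zeroʳ)
open import Data.Fin using (Fin; zero; suc; toℕ; fromℕ; inject₁; lower₁; _≟_)
open import Data.Fin.Properties
  using ( toℕ-fromℕ; toℕ-inject₁; toℕ<n; toℕ-injective; inject₁-lower₁; inject₁-injective
        ; fromℕ≢inject₁ )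
open import Data.Fin.Subset using (Subset; Side; inside; outside; _∈_; _∉_; _∩_; _-_; ∁; ⊤; ⊥; ∣_∣)
open import Data.Fin.Subset.Properties
  using ( _∈?_; drop-there; ∉⊥; ∈⊤; x∉p⇒x∈∁p; x∈p∩q⁺; x∈p∩q⁻; x∈p∧x≢y⇒x∈p-y
        ; p─q⊆p; p─⊥≡p; x∈p⇒∣p-x∣<∣p∣; Empty-unique; ∣⊥∣≡0; ∣⊤∣≡n; ∣∁p∣≡n∸∣p∣
        ; p⊆q⇒∣p∣≤∣q∣ )
open import Data.Vec using ([]; _∷_; here; there; tabulate)
open import Data.Vec.Properties using (lookup∘tabulate; lookup⇒[]=; []=⇒lookup)
open import Data.List as List using (List; []; _∷_; _++_; length; filter)
open import Data.List.Properties
  using ( length-filter; filter-all; filter-complete; filter-accept; filter-reject; filter-some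
        ; filter-++; length-++ )
open import Data.List.Relation.Unary.All as All using (All; []; _∷_)
import Data.List.Relation.Unary.All.Properties as All
open import Data.List.Relation.Unary.AllPairs using (AllPairs; []; _∷_)
import Data.List.Relation.Unary.AllPairs.Properties as AllPairs
open import Data.List.Relation.Unary.Any as Any using ()
open import Data.List.Relation.Unary.Any.Properties using (¬Any[])
open import Data.List.Membership.Propositional using () renaming (_∈_ to _∈ₗ_)
open import Data.Product using (_×_; _,_; proj₁; proj₂)
open import Data.Sum as Sum using (_⊎_; inj₁; inj₂)
open import Data.Empty using (⊥-elim)
open import Function using (_∘_)
open import Relation.Nullary using (Dec; yes; no)
open import Relation.Nullary.Decidable using (⌊_⌋; True; toWitness; dec-true; dec-false; isYes≗does)
open import Relation.Binary.PropositionalEquality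
open import Algebra.Properties.CommutativeMonoid.Sum +-0-commutativeMonoid
  using (sum-syntax; ∑-distrib-+; sum-init-last; sum-cong-≗; sum-replicate-zero)

private variable
  n : ℕ
  p r : Subset n
  z : Fin n
  zs : List (Fin n)

[d+n]/d≡1+n/d : ∀ d n .{{_ : NonZero d}} → (d + n) / d ≡ suc (n / d)
[d+n]/d≡1+n/d d n = trans (+-distrib-/-∣ˡ n ∣-refl) (cong (_+ n / d) (n/n≡1 d))

⌊n/2⌋≡n/2 : ∀ n → ⌊ n /2⌋ ≡ n / 2
⌊n/2⌋≡n/2 0             = refl
⌊n/2⌋≡n/2 1             = refl
⌊n/2⌋≡n/2 (suc (suc n)) = trans (cong suc (⌊n/2⌋≡n/2 n)) (sym ([d+n]/d≡1+n/d 2 n))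

⌈n/2⌉≡[n+1]/2 : ∀ n → ⌈ n /2⌉ ≡ (n + 1) / 2
⌈n/2⌉≡[n+1]/2 n = trans (⌊n/2⌋≡n/2 (suc n)) (cong (_/ 2) (+-comm 1 n))

⌈n/2⌉≤ : ∀ {n s} → n * 2 ≤ 4 * s → ⌈ n /2⌉ ≤ s
⌈n/2⌉≤ {n} {s} n*2≤4*s = ≤-trans (⌈n/2⌉-mono n≤s+s) (≤-reflexive (sym (n≡⌈n+n/2⌉ s)))
  where
  4*t≡[t+t]*2 : ∀ t → 4 * t ≡ (t + t) * 2
  4*t≡[t+t]*2 = solve-∀
  n≤s+s : n ≤ s + s
  n≤s+s = *-cancelʳ-≤ n (s + s) 2 (≤-trans n*2≤4*s (≤-reflexive (4*t≡[t+t]*2 s)))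

n∸n/5≤ : ∀ {n s} → n * 4 ≤ 5 * s → n ∸ n / 5 ≤ s
n∸n/5≤ {n} {s} n*4≤5*s = m≤n+o⇒m∸n≤o n (n / 5) (begin
  n             ≤⟨ m≤n+m∸n n s ⟩
  s + (n ∸ s)   ≤⟨ +-monoʳ-≤ s n∸s≤n/5 ⟩
  s + n / 5     ≡⟨ +-comm s (n / 5) ⟩
  n / 5 + s     ∎)
  where
  open ≤-Reasoning
  [n∸s]*5≤n : (n ∸ s) * 5 ≤ n
  [n∸s]*5≤n = begin
    (n ∸ s) * 5        ≡⟨ *-distribʳ-∸ 5 n s ⟩
    n * 5 ∸ s * 5      ≤⟨ ∸-monoʳ-≤ (n * 5) (≤-trans n*4≤5*s (≤-reflexive (*-comm 5 s))) ⟩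
    n * 5 ∸ n * 4      ≡⟨ cong (_∸ n * 4) (*-suc n 4) ⟩
    n + n * 4 ∸ n * 4  ≡⟨ m+n∸n≡m n (n * 4) ⟩
    n                  ∎
  n∸s≤n/5 : n ∸ s ≤ n / 5
  n∸s≤n/5 = ≤-trans (≤-reflexive (sym (m*n/n≡m (n ∸ s) 5))) (/-monoˡ-≤ 5 [n∸s]*5≤n)

⌊⌋-true : ∀ {i j : ℕ} → i ≡ j → ⌊ i ≟ℕ j ⌋ ≡ true
⌊⌋-true {i} {j} i≡j = trans (isYes≗does (i ≟ℕ j)) (dec-true (i ≟ℕ j) i≡j)

⌊⌋-false : ∀ {i j : ℕ} → i ≢ j → ⌊ i ≟ℕ j ⌋ ≡ false
⌊⌋-false {i} {j} i≢j = trans (isYes≗does (i ≟ℕ j)) (dec-false (i ≟ℕ j) i≢j)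

-- Counting the entries of a list that lie in a subset

x∉p-x : ∀ {p : Subset n} {x} → x ∉ p - x
x∉p-x {p = _ ∷ _} {suc x} (there x∈p-x) = x∉p-x x∈p-x

∣p∣≤1+∣p-x∣ : ∀ (p : Subset n) x → ∣ p ∣ ≤ suc ∣ p - x ∣
∣p∣≤1+∣p-x∣ (inside  ∷ p) zero    = s≤s (≤-reflexive (cong ∣_∣ (sym (p─⊥≡p p))))
∣p∣≤1+∣p-x∣ (outside ∷ p) zero    = ≤-trans (≤-reflexive (cong ∣_∣ (sym (p─⊥≡p p)))) (n≤1+n _)
∣p∣≤1+∣p-x∣ (inside  ∷ p) (suc x) = s≤s (∣p∣≤1+∣p-x∣ p x)
∣p∣≤1+∣p-x∣ (outside ∷ p) (suc x) = ∣p∣≤1+∣p-x∣ p x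

count : Subset n → List (Fin n) → ℕ
count p zs = length (filter (_∈? p) zs)

count-∈ : z ∈ p → count p (z ∷ zs) ≡ suc (count p zs)
count-∈ z∈p = cong length (filter-accept (_∈? _) z∈p)

count-∉ : z ∉ p → count p (z ∷ zs) ≡ count p zs
count-∉ z∉p = cong length (filter-reject (_∈? _) z∉p)

count-++ : ∀ (p : Subset n) xs ys → count p (xs ++ ys) ≡ count p xs + count p ys
count-++ p xs ys = trans (cong length (filter-++ (_∈? p) xs ys)) (length-++ (filter (_∈? p) xs))

count-++-mono : ∀ {p : Subset n} {k l} xs ys →
                k ≤ count p xs → l ≤ count p ys → k + l ≤ count p (xs ++ ys)
count-++-mono {p = p} xs ys k≤ l≤ = ≤-trans (+-mono-≤ k≤ l≤) (≤-reflexive (sym (count-++ p xs ys)))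

count-∷ : ∀ (p : Subset n) z zs → count p zs ≤ count p (z ∷ zs)
count-∷ p z zs = ≤-trans (m≤n+m _ (count p (z ∷ []))) (≤-reflexive (sym (count-++ p (z ∷ []) zs)))

count-all : All (_∈ p) zs → count p zs ≡ length zs
count-all {p = p} zs⊆p = cong length (filter-all (_∈? p) zs⊆p)

count-⊤ : ∀ (zs : List (Fin n)) → count ⊤ zs ≡ length zs
count-⊤ zs = count-all {zs = zs} (All.tabulate λ _ → ∈⊤)

count-full : ∀ (p : Subset n) zs → length zs ≤ count p zs → All (_∈ p) zs
count-full p zs full = subst (All (_∈ p))
  (filter-complete (_∈? p) (≤-antisym (length-filter (_∈? p) zs) full))
  (All.all-filter (_∈? p) zs)

count-pair : ∀ {u v} → u ∈ p ⊎ v ∈ p → 1 ≤ count p (u ∷ v ∷ [])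
count-pair {p = p} {u} {v} (inj₁ u∈p) = filter-some (_∈? p) {u ∷ v ∷ []} (Any.here u∈p)
count-pair {p = p} {u} {v} (inj₂ v∈p) = filter-some (_∈? p) {u ∷ v ∷ []} (Any.there (Any.here v∈p))

count-AllPairs : AllPairs (λ u v → u ∈ p ⊎ v ∈ p) zs → length zs ≤ suc (count p zs)
count-AllPairs [] = z≤n
count-AllPairs {p = p} {z ∷ zs} (z-or ∷ rest) with z ∈? p
... | yes _   = s≤s (count-AllPairs rest)
... | no z∉p  = s≤s (≤-reflexive (sym (count-all (All.map (Sum.fromInj₂ (⊥-elim ∘ z∉p)) z-or))))

count≤∣∣ : AllPairs _≢_ zs → All (λ z → z ∈ p → z ∈ r) zs → count p zs ≤ ∣ r ∣
count≤∣∣ [] [] = z≤n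
count≤∣∣ {zs = z ∷ zs} {p = p} {r = r} (z∉zs ∷ distinct) (z∈r ∷ zs∈r) with z ∈? p
... | yes z∈p =
  ≤-trans (s≤s (count≤∣∣ distinct (remove z∉zs zs∈r))) (x∈p⇒∣p-x∣<∣p∣ (z∈r z∈p))
  where
  remove : ∀ {vs} → All (z ≢_) vs → All (λ v → v ∈ p → v ∈ r) vs →
           All (λ v → v ∈ p → v ∈ r - z) vs
  remove []           []           = []
  remove (z≢v ∷ z≢vs) (v∈r ∷ vs∈r) =
    (λ v∈p → x∈p∧x≢y⇒x∈p-y (v∈r v∈p) (≢-sym z≢v)) ∷ remove z≢vs vs∈r
... | no _ = count≤∣∣ distinct zs∈r

∣∣≤count : ∀ (p r : Subset n) zs →
           (∀ {z} → z ∈ r → z ∈ p × z ∈ₗ zs) → ∣ r ∣ ≤ count p zs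
∣∣≤count {n} p r [] covered = ≤-reflexive (trans (cong ∣_∣ r≡⊥) (∣⊥∣≡0 n))
  where r≡⊥ = Empty-unique λ (_ , z∈r) → ¬Any[] (proj₂ (covered z∈r))
∣∣≤count p r (z ∷ zs) covered with z ∈? r
... | yes z∈r = begin
  ∣ r ∣             ≤⟨ ∣p∣≤1+∣p-x∣ r z ⟩
  suc ∣ r - z ∣     ≤⟨ s≤s (∣∣≤count p (r - z) zs covered′) ⟩
  suc (count p zs)  ≡⟨ count-∈ (proj₁ (covered z∈r)) ⟨
  count p (z ∷ zs)  ∎
  where
  open ≤-Reasoning
  covered′ : ∀ {v} → v ∈ r - z → v ∈ p × v ∈ₗ zs
  covered′ v∈ with covered (p─q⊆p r _ v∈)
  ... | _   , Any.here refl    = ⊥-elim (x∉p-x v∈)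
  ... | v∈p , Any.there v∈zs = v∈p , v∈zs
... | no z∉r = ≤-trans (∣∣≤count p r zs covered′) (count-∷ p z zs)
  where
  covered′ : ∀ {v} → v ∈ r → v ∈ p × v ∈ₗ zs
  covered′ v∈r with covered v∈r
  ... | _   , Any.here refl    = ⊥-elim (z∉r v∈r)
  ... | v∈p , Any.there v∈zs = v∈p , v∈zs

count≤∣∩∣ : ∀ {p q : Subset n} →
            AllPairs _≢_ zs → All (_∈ q) zs → count p zs ≤ ∣ p ∩ q ∣
count≤∣∩∣ distinct zs⊆q =
  count≤∣∣ distinct (All.map (λ z∈q z∈p → x∈p∩q⁺ (z∈p , z∈q)) zs⊆q)

∣∩∣≤count : ∀ (p q : Subset n) zs →
            (∀ {z} → z ∈ q → z ∈ₗ zs) → ∣ p ∩ q ∣ ≤ count p zs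
∣∩∣≤count p q zs q⊆zs = ∣∣≤count p (p ∩ q) zs λ z∈p∩q →
  let (z∈p , z∈q) = x∈p∩q⁻ p q z∈p∩q in z∈p , q⊆zs z∈q

∑-≥ : ∀ c {f : Fin n → ℕ} → (∀ i → c ≤ f i) → n * c ≤ ∑[ i < n ] f i
∑-≥ {zero}  c c≤f = z≤n
∑-≥ {suc n} c c≤f = +-mono-≤ (c≤f zero) (∑-≥ c (c≤f ∘ suc))

count-there : ∀ s (p : Subset n) u → count (s ∷ p) (suc u ∷ []) ≡ count p (u ∷ [])
count-there s p u = by-cases (u ∈? p)
  where
  by-cases : Dec (u ∈ p) → count (s ∷ p) (suc u ∷ []) ≡ count p (u ∷ [])
  by-cases (yes u∈p) = trans (count-∈ {zs = []} (there u∈p)) (sym (count-∈ {zs = []} u∈p))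
  by-cases (no u∉p)  =
    trans (count-∉ {zs = []} (u∉p ∘ drop-there)) (sym (count-∉ {zs = []} u∉p))

∣p∣≡∑count : ∀ (p : Subset n) → ∣ p ∣ ≡ ∑[ u < n ] count p (u ∷ [])
∣p∣≡∑count []            = refl
∣p∣≡∑count (inside  ∷ p) =
  cong suc (trans (∣p∣≡∑count p) (sum-cong-≗ (sym ∘ count-there inside p)))
∣p∣≡∑count (outside ∷ p) = trans (∣p∣≡∑count p) (sum-cong-≗ (sym ∘ count-there outside p))

-- Distinguishing vertices in an arbitrary graph

module _ (G : Graph n) where

  d₂-refl : ∀ u → d₂ G u u ≡ 0
  d₂-refl u with u ≟ u
  ... | yes _   = refl
  ... | no u≢u  = ⊥-elim (u≢u refl)

  d₂-adjacent : ∀ {u z} → u ≢ z → G u z ≡ true → d₂ G u z ≡ 1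
  d₂-adjacent {u} {z} u≢z adj with u ≟ z
  ... | yes u≡z = ⊥-elim (u≢z u≡z)
  ... | no _ rewrite adj = refl

  d₂-nonadjacent : ∀ {u z} → u ≢ z → G u z ≡ false → d₂ G u z ≡ 2
  d₂-nonadjacent {u} {z} u≢z nonadj with u ≟ z
  ... | yes u≡z = ⊥-elim (u≢z u≡z)
  ... | no _ rewrite nonadj = refl

  d₂-≢0 : ∀ {u z} → u ≢ z → d₂ G u z ≢ 0
  d₂-≢0 {u} {z} u≢z with u ≟ z | G u z
  ... | yes u≡z | _     = ⊥-elim (u≢z u≡z)
  ... | no _    | true  = λ ()
  ... | no _    | false = λ ()

  ∈-distinguishers : ∀ {x y z} → d₂ G x z ≢ d₂ G y z → z ∈ distinguishers G x y
  ∈-distinguishers {x} {y} {z} ne = lookup⇒[]= z _ (trans (lookup∘tabulate _ z) marked)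
    where
    marked : (if ⌊ d₂ G x z ≟ℕ d₂ G y z ⌋ then false else true) ≡ true
    marked with d₂ G x z ≟ℕ d₂ G y z
    ... | yes eq = ⊥-elim (ne eq)
    ... | no _   = refl

  ∈-distinguishers⁻ : ∀ x y {z} → z ∈ distinguishers G x y → d₂ G x z ≢ d₂ G y z
  ∈-distinguishers⁻ x y {z} z∈ eq = unmarked (trans (sym (lookup∘tabulate _ z)) ([]=⇒lookup z∈))
    where
    unmarked : (if ⌊ d₂ G x z ≟ℕ d₂ G y z ⌋ then false else true) ≢ true
    unmarked with d₂ G x z ≟ℕ d₂ G y z
    ... | yes _ = λ ()
    ... | no ne = ⊥-elim (ne eq)

  distinguishers-sym : ∀ x y {z} → z ∈ distinguishers G x y → z ∈ distinguishers G y x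
  distinguishers-sym x y z∈ = ∈-distinguishers {y} {x} (∈-distinguishers⁻ x y z∈ ∘ sym)

  distinguished-by : ∀ x y {z i j} →
    d₂ G x z ≡ i → d₂ G y z ≡ j → i ≢ j → z ∈ distinguishers G x y
  distinguished-by x y refl refl i≢j = ∈-distinguishers {x} {y} i≢j

  left-distinguished : ∀ {x y} → x ≢ y → x ∈ distinguishers G x y
  left-distinguished {x} {y} x≢y =
    ∈-distinguishers {x} {y} λ eq → d₂-≢0 (x≢y ∘ sym) (trans (sym eq) (d₂-refl x))

  right-distinguished : ∀ {x y} → x ≢ y → y ∈ distinguishers G x y
  right-distinguished {x} {y} x≢y =
    ∈-distinguishers {x} {y} λ eq → d₂-≢0 x≢y (trans eq (d₂-refl y))

alternating : (n : ℕ) → Side → Subset n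
alternating zero    s = []
alternating (suc n) s = s ∷ alternating n (not s)

∣alternating∣ : ∀ n →
  ∣ alternating n inside ∣ ≡ ⌈ n /2⌉ × ∣ alternating n outside ∣ ≡ ⌊ n /2⌋
∣alternating∣ zero    = refl , refl
∣alternating∣ (suc n) = cong suc (proj₂ (∣alternating∣ n)) , proj₁ (∣alternating∣ n)

alternating-consecutive : ∀ s (i : Fin n) →
  suc i ∈ alternating (suc n) s ⊎ inject₁ i ∈ alternating (suc n) s
alternating-consecutive inside  zero    = inj₂ here
alternating-consecutive outside zero    = inj₁ (there here)
alternating-consecutive s       (suc i) = Sum.map there there (alternating-consecutive (not s) i)

everyFifth : (n : ℕ) → Subset n
everyFifth (suc (suc (suc (suc (suc n))))) =
  inside ∷ outside ∷ outside ∷ outside ∷ outside ∷ everyFifth n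
everyFifth n = ⊥

∣everyFifth∣ : ∀ n → ∣ everyFifth n ∣ ≡ n / 5
∣everyFifth∣ 0 = refl
∣everyFifth∣ 1 = refl
∣everyFifth∣ 2 = refl
∣everyFifth∣ 3 = refl
∣everyFifth∣ 4 = refl
∣everyFifth∣ (suc (suc (suc (suc (suc n))))) =
  trans (cong suc (∣everyFifth∣ n)) (sym ([d+n]/d≡1+n/d 5 n))

-- The last block may be incomplete, so the final member is at least five steps below n.
everyFifth-∈ : ∀ n {u : Fin n} → u ∈ everyFifth n → 5 ∣ toℕ u × toℕ u + 5 ≤ n
everyFifth-∈ 1 u∈ = ⊥-elim (∉⊥ u∈)
everyFifth-∈ 2 u∈ = ⊥-elim (∉⊥ u∈)
everyFifth-∈ 3 u∈ = ⊥-elim (∉⊥ u∈)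
everyFifth-∈ 4 u∈ = ⊥-elim (∉⊥ u∈)
everyFifth-∈ (suc (suc (suc (suc (suc n))))) here = (5 ∣0) , s≤s (s≤s (s≤s (s≤s (s≤s z≤n))))
everyFifth-∈ (suc (suc (suc (suc (suc n))))) (there (there (there (there (there u∈))))) =
  let (5∣u , u+5≤n) = everyFifth-∈ n u∈
  in ∣m∣n⇒∣m+n ∣-refl 5∣u , s≤s (s≤s (s≤s (s≤s (s≤s u+5≤n))))

-- The cycle

module Cycle (m : ℕ) (4≤m : 4 ≤ m) where

  N : ℕ
  N = suc m

  open import Data.List.Membership.DecPropositional (_≟_ {N}) using () renaming (_∈?_ to _∈ₗ?_)

  G : Graph N
  G = cycle N

  C : Fin N → Fin N → Subset N
  C = distinguishers G

  prev : Fin N → Fin N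
  prev zero    = fromℕ m
  prev (suc i) = inject₁ i

  prev^ : ℕ → Fin N → Fin N
  prev^ zero    u = u
  prev^ (suc k) u = prev (prev^ k u)

  next : Fin N → Fin N
  next u with m ≟ℕ toℕ u
  ... | yes _  = zero
  ... | no m≢u = suc (lower₁ u m≢u)

  prev-next : ∀ u → prev (next u) ≡ u
  prev-next u with m ≟ℕ toℕ u
  ... | yes m≡u = toℕ-injective (trans (toℕ-fromℕ m) m≡u)
  ... | no m≢u  = inject₁-lower₁ u m≢u

  prev-injective : ∀ {u v} → prev u ≡ prev v → u ≡ v
  prev-injective {zero}  {zero}  _ = refl
  prev-injective {zero}  {suc j} e = ⊥-elim (fromℕ≢inject₁ e)
  prev-injective {suc i} {zero}  e = ⊥-elim (fromℕ≢inject₁ (sym e))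
  prev-injective {suc i} {suc j} e = cong suc (inject₁-injective e)

  prev-≢ : ∀ {u v} → u ≢ v → prev u ≢ prev v
  prev-≢ u≢v = u≢v ∘ prev-injective

  toℕ-prev : ∀ u → toℕ u ≡ suc (toℕ (prev u)) % N
  toℕ-prev zero    = sym (trans (cong (λ k → suc k % N) (toℕ-fromℕ m)) (n%n≡0 N))
  toℕ-prev (suc i) rewrite toℕ-inject₁ i = sym (m<n⇒m%n≡m (s≤s (toℕ<n i)))

  toℕ-next : ∀ u → toℕ (next u) ≡ suc (toℕ u) % N
  toℕ-next u = trans (toℕ-prev (next u)) (cong (λ v → suc (toℕ v) % N) (prev-next u))

  prev-step : ∀ u → suc (toℕ (prev u)) ≡ toℕ u ⊎ suc (toℕ (prev u)) ≡ toℕ u + N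
  prev-step zero    = inj₂ (cong suc (toℕ-fromℕ m))
  prev-step (suc i) = inj₁ (cong suc (toℕ-inject₁ i))

  -- Fewer than N steps back wrap around past 0 at most once.
  toℕ-prev^ : ∀ k u → k < N →
    toℕ (prev^ k u) + k ≡ toℕ u ⊎ toℕ (prev^ k u) + k ≡ toℕ u + N
  toℕ-prev^ zero    u _   = inj₁ (+-identityʳ (toℕ u))
  toℕ-prev^ (suc k) u k<N with toℕ-prev^ k u (≤-trans (n≤1+n (suc k)) k<N) | prev-step (prev^ k u)
  ... | inj₁ e | inj₁ s = inj₁ (trans (+-suc _ k) (trans (cong (_+ k) s) e))
  ... | inj₂ e | inj₁ s = inj₂ (trans (+-suc _ k) (trans (cong (_+ k) s) e))
  ... | inj₁ e | inj₂ s = inj₂ (begin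
        toℕ (prev^ (suc k) u) + suc k    ≡⟨ +-suc _ k ⟩
        suc (toℕ (prev^ (suc k) u)) + k  ≡⟨ cong (_+ k) s ⟩
        toℕ (prev^ k u) + N + k          ≡⟨ +-assoc (toℕ (prev^ k u)) N k ⟩
        toℕ (prev^ k u) + (N + k)        ≡⟨ cong (toℕ (prev^ k u) +_) (+-comm N k) ⟩
        toℕ (prev^ k u) + (k + N)        ≡⟨ sym (+-assoc (toℕ (prev^ k u)) k N) ⟩
        toℕ (prev^ k u) + k + N          ≡⟨ cong (_+ N) e ⟩
        toℕ u + N                        ∎)
    where open ≡-Reasoning
  ... | inj₂ e | inj₂ s = ⊥-elim (<⇒≱ k<N (≤-trans N≤k (n≤1+n k)))
    where
    v≡0 : toℕ (prev^ k u) ≡ 0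
    v≡0 = n≤0⇒n≡0 (+-cancelʳ-≤ N _ 0 (subst (_≤ N) s (toℕ<n (prev^ (suc k) u))))
    N≤k : N ≤ k
    N≤k = subst (N ≤_) (trans (sym e) (cong (_+ k) v≡0)) (m≤n+m N (toℕ u))

  prev^-≢ : ∀ k u → 0 < k → k < N → prev^ k u ≢ u
  prev^-≢ k u 0<k k<N eq with toℕ-prev^ k u k<N
  ... | inj₁ e = <⇒≢ 0<k (sym (+-cancelˡ-≡ (toℕ u) k 0
                   (trans (trans (cong (λ v → toℕ v + k) (sym eq)) e) (sym (+-identityʳ (toℕ u))))))
  ... | inj₂ e = <⇒≢ k<N (+-cancelˡ-≡ (toℕ u) k N (trans (cong (λ v → toℕ v + k) (sym eq)) e))

  Near : (Fin N → Fin N → Set) → Set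
  Near R = ∀ k u {_ : True (1 ≤ℕ? k)} {_ : True (k ≤ℕ? 4)} → R u (prev^ k u)

  apart : Near _≢_
  apart k u {1≤k} {k≤4} =
    ≢-sym (prev^-≢ k u (toWitness 1≤k) (s≤s (≤-trans (toWitness k≤4) 4≤m)))

  adjacent-prev : ∀ u → G (prev u) u ≡ true
  adjacent-prev u = cong (_∨ ⌊ toℕ (prev u) ≟ℕ suc (toℕ u) % N ⌋) (⌊⌋-true (toℕ-prev u))

  adjacent-prev˘ : ∀ u → G u (prev u) ≡ true
  adjacent-prev˘ u = trans (cong (b ∨_) (⌊⌋-true (toℕ-prev u))) (∨-zeroʳ b)
    where b = ⌊ toℕ (prev u) ≟ℕ suc (toℕ u) % N ⌋

  nonadjacent : ∀ {u z} → z ≢ prev u → u ≢ prev z → G u z ≡ false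
  nonadjacent {u} {z} z≢ u≢ =
    cong₂ _∨_ (⌊⌋-false (u≢ ∘ is-prev {u} {z})) (⌊⌋-false (z≢ ∘ is-prev {z} {u}))
    where
    is-prev : ∀ {v w} → toℕ w ≡ suc (toℕ v) % N → v ≡ prev w
    is-prev {v} {w} e =
      trans (sym (prev-next v)) (cong prev (toℕ-injective (trans (toℕ-next v) (sym e))))

  d₂-prev : ∀ u → d₂ G (prev u) u ≡ 1
  d₂-prev u = d₂-adjacent G (apart 1 u ∘ sym) (adjacent-prev u)

  d₂-prev˘ : ∀ u → d₂ G u (prev u) ≡ 1
  d₂-prev˘ u = d₂-adjacent G (apart 1 u) (adjacent-prev˘ u)

  d₂-far : ∀ {u z} → u ≢ z → z ≢ prev u → u ≢ prev z → d₂ G u z ≡ 2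
  d₂-far u≢z z≢ u≢ = d₂-nonadjacent G u≢z (nonadjacent z≢ u≢)

  pair triple : Fin N → List (Fin N)
  pair   u = u ∷ prev u ∷ []
  triple u = u ∷ pair (prev u)

  -- span₁ a and span₂ a list 𝒞(prev a, prev² a) and 𝒞(prev a, prev³ a).
  span₁ span₂ : Fin N → List (Fin N)
  span₁ a = pair a ++ pair (prev^ 2 a)
  span₂ a = pair a ++ pair (prev^ 3 a)

  span₁-AllPairs : ∀ {R} → Near R → ∀ a → AllPairs R (span₁ a)
  span₁-AllPairs near a =
      (near 1 a ∷ near 2 a ∷ near 3 a ∷ [])
    ∷ (near 1 (prev a) ∷ near 2 (prev a) ∷ [])
    ∷ (near 1 (prev^ 2 a) ∷ [])
    ∷ [] ∷ []

  span₂-AllPairs : ∀ {R} → Near R → ∀ a → AllPairs R (span₂ a)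
  span₂-AllPairs near a =
      (near 1 a ∷ near 3 a ∷ near 4 a ∷ [])
    ∷ (near 2 (prev a) ∷ near 3 (prev a) ∷ [])
    ∷ (near 1 (prev^ 3 a) ∷ [])
    ∷ [] ∷ []

  triple-AllPairs : ∀ {R} → Near R → ∀ a → AllPairs R (triple a)
  triple-AllPairs near a = (near 1 a ∷ near 2 a ∷ []) ∷ (near 1 (prev a) ∷ []) ∷ [] ∷ []

  span₁⊆C : ∀ a → All (_∈ C (prev a) (prev^ 2 a)) (span₁ a)
  span₁⊆C a =
      distinguished-by G (prev a) (prev^ 2 a) (d₂-prev a)
        (d₂-far (apart 2 a ∘ sym) (apart 3 a) (apart 1 (prev a) ∘ sym)) (λ ())
    ∷ left-distinguished G (apart 1 (prev a))
    ∷ right-distinguished G (apart 1 (prev a))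
    ∷ distinguished-by G (prev a) (prev^ 2 a)
        (d₂-far (apart 2 (prev a)) (apart 1 (prev^ 2 a) ∘ sym) (apart 3 (prev a)))
        (d₂-prev˘ (prev^ 2 a)) (λ ())
    ∷ []

  span₂⊆C : ∀ a → All (_∈ C (prev a) (prev^ 3 a)) (span₂ a)
  span₂⊆C a =
      distinguished-by G (prev a) (prev^ 3 a) (d₂-prev a)
        (d₂-far (apart 3 a ∘ sym) (apart 4 a) (apart 2 (prev a) ∘ sym)) (λ ())
    ∷ left-distinguished G (apart 2 (prev a))
    ∷ right-distinguished G (apart 2 (prev a))
    ∷ distinguished-by G (prev a) (prev^ 3 a)
        (d₂-far (apart 3 (prev a)) (apart 2 (prev^ 2 a) ∘ sym) (apart 4 (prev a)))
        (d₂-prev˘ (prev^ 3 a)) (λ ())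
    ∷ []

  C⊆span₁ : ∀ a {z} → z ∈ C (prev a) (prev^ 2 a) → z ∈ₗ span₁ a
  C⊆span₁ a {z} z∈C with z ∈ₗ? span₁ a
  ... | yes z∈ = z∈
  ... | no z∉ with All.¬Any⇒All¬ (span₁ a) z∉
  ...   | z≢a ∷ z≢πa ∷ z≢π²a ∷ z≢π³a ∷ [] =
        ⊥-elim (∈-distinguishers⁻ G (prev a) (prev^ 2 a) z∈C (trans (d₂-far (≢-sym z≢πa) z≢π²a (prev-≢ (≢-sym z≢a)))
                 (sym (d₂-far (≢-sym z≢π²a) z≢π³a (prev-≢ (≢-sym z≢πa))))))

  -- prev² a is adjacent to both prev a and prev³ a, which is why it is missing from span₂ a.
  C⊆span₂ : ∀ a {z} → z ∈ C (prev a) (prev^ 3 a) → z ∈ₗ span₂ a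
  C⊆span₂ a {z} z∈C with z ∈ₗ? span₂ a | z ≟ prev^ 2 a
  ... | yes z∈ | _ = z∈
  ... | no _ | yes refl = ⊥-elim (∈-distinguishers⁻ G (prev a) (prev^ 3 a) z∈C
        (trans (d₂-prev˘ (prev a)) (sym (d₂-prev (prev^ 2 a)))))
  ... | no z∉ | no z≢π²a with All.¬Any⇒All¬ (span₂ a) z∉
  ...   | z≢a ∷ z≢πa ∷ z≢π³a ∷ z≢π⁴a ∷ [] =
        ⊥-elim (∈-distinguishers⁻ G (prev a) (prev^ 3 a) z∈C (trans (d₂-far (≢-sym z≢πa) z≢π²a (prev-≢ (≢-sym z≢a)))
                 (sym (d₂-far (≢-sym z≢π³a) z≢π⁴a (prev-≢ (≢-sym z≢π²a))))))

  -- prev a and prev b are at distance at least 3.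
  Far : Fin N → Fin N → Set
  Far a b = prev a ≢ prev b × b ≢ prev a × a ≢ prev b × b ≢ prev^ 2 a × a ≢ prev^ 2 b

  Far-sym : ∀ {a b} → Far a b → Far b a
  Far-sym (x≢y , b≢πa , a≢πb , b≢π²a , a≢π²b) =
    ≢-sym x≢y , a≢πb , b≢πa , a≢π²b , b≢π²a

  triple⊆C : ∀ {a b} → Far a b → All (_∈ C (prev a) (prev b)) (triple a)
  triple⊆C {a} {b} (x≢y , b≢πa , a≢πb , b≢π²a , a≢π²b) =
      distinguished-by G (prev a) (prev b) (d₂-prev a)
        (d₂-far (≢-sym a≢πb) a≢π²b (≢-sym x≢y)) (λ ())
    ∷ left-distinguished G x≢y
    ∷ distinguished-by G (prev a) (prev b) (d₂-prev˘ (prev a))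
        (d₂-far (prev-≢ b≢πa) (prev-≢ x≢y) (prev-≢ b≢π²a)) (λ ())
    ∷ []

  far⊆C : ∀ {a b} → Far a b → All (_∈ C (prev a) (prev b)) (triple a ++ triple b)
  far⊆C {a} {b} far = All.++⁺ (triple⊆C far)
    (All.map (distinguishers-sym G (prev b) (prev a)) (triple⊆C (Far-sym far)))

  far-distinct : ∀ {a b} → Far a b → AllPairs _≢_ (triple a ++ triple b)
  far-distinct {a} {b} (x≢y , b≢πa , a≢πb , b≢π²a , a≢π²b) =
    AllPairs.++⁺ (triple-AllPairs apart a) (triple-AllPairs apart b)
      ( (x≢y ∘ cong prev ∷ a≢πb ∷ a≢π²b ∷ [])
      ∷ (≢-sym b≢πa ∷ x≢y ∷ prev-≢ a≢πb ∷ [])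
      ∷ (≢-sym b≢π²a ∷ prev-≢ (≢-sym b≢πa) ∷ prev-≢ x≢y ∷ [])
      ∷ [])

  generator-criterion : ∀ k S →
    (∀ a → k ≤ count S (span₁ a)) → (∀ a → k ≤ count S (span₂ a)) →
    (∀ a b → k ≤ count S (triple a ++ triple b)) → IsKAdjGenerator k G S
  generator-criterion k S on-span₁ on-span₂ on-far x y x≢y =
    subst₂ (λ x y → k ≤ ∣ S ∩ C x y ∣) (prev-next x) (prev-next y)
      (bound (next x) (next y) (subst₂ _≢_ (sym (prev-next x)) (sym (prev-next y)) x≢y))
    where
    via : ∀ x y {zs} → k ≤ count S zs → AllPairs _≢_ zs → All (_∈ C x y) zs →
          k ≤ ∣ S ∩ C x y ∣
    via x y k≤ distinct zs⊆C = ≤-trans k≤ (count≤∣∩∣ distinct zs⊆C)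

    via˘ : ∀ x y {zs} → k ≤ count S zs → AllPairs _≢_ zs → All (_∈ C x y) zs →
           k ≤ ∣ S ∩ C y x ∣
    via˘ x y k≤ distinct zs⊆C = via y x k≤ distinct (All.map (distinguishers-sym G x y) zs⊆C)

    bound : ∀ a b → prev a ≢ prev b → k ≤ ∣ S ∩ C (prev a) (prev b) ∣
    bound a b x≢y with b ≟ prev a | a ≟ prev b | b ≟ prev^ 2 a | a ≟ prev^ 2 b
    ... | yes refl | _ | _ | _ =
      via (prev a) (prev^ 2 a) (on-span₁ a) (span₁-AllPairs apart a) (span₁⊆C a)
    ... | no _ | yes refl | _ | _ =
      via˘ (prev b) (prev^ 2 b) (on-span₁ b) (span₁-AllPairs apart b) (span₁⊆C b)
    ... | no _ | no _ | yes refl | _ =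
      via (prev a) (prev^ 3 a) (on-span₂ a) (span₂-AllPairs apart a) (span₂⊆C a)
    ... | no _ | no _ | no _ | yes refl =
      via˘ (prev b) (prev^ 3 b) (on-span₂ b) (span₂-AllPairs apart b) (span₂⊆C b)
    ... | no b≢πa | no a≢πb | no b≢π²a | no a≢π²b =
      via (prev a) (prev b) (on-far a b) (far-distinct far) (far⊆C far)
      where far = x≢y , b≢πa , a≢πb , b≢π²a , a≢π²b

  generator-on-span₁ : ∀ {k S} → IsKAdjGenerator k G S → ∀ a → k ≤ count S (span₁ a)
  generator-on-span₁ {S = S} gen a = ≤-trans (gen (prev a) (prev^ 2 a) (apart 1 (prev a)))
    (∣∩∣≤count S (C (prev a) (prev^ 2 a)) (span₁ a) (C⊆span₁ a))

  generator-on-span₂ : ∀ {k S} → IsKAdjGenerator k G S → ∀ a → k ≤ count S (span₂ a)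
  generator-on-span₂ {S = S} gen a = ≤-trans (gen (prev a) (prev^ 3 a) (apart 2 (prev a)))
    (∣∩∣≤count S (C (prev a) (prev^ 3 a)) (span₂ a) (C⊆span₂ a))

  ∑-prev : ∀ (f : Fin N → ℕ) → ∑[ u < N ] f (prev u) ≡ ∑[ u < N ] f u
  ∑-prev f = trans (+-comm (f (fromℕ m)) (∑[ i < m ] f (inject₁ i))) (sym (sum-init-last f))

  ∑-prev^ : ∀ k (f : Fin N → ℕ) → ∑[ u < N ] f (prev^ k u) ≡ ∑[ u < N ] f u
  ∑-prev^ zero    f = refl
  ∑-prev^ (suc k) f = trans (∑-prev^ k (f ∘ prev)) (∑-prev f)

  window : List ℕ → Fin N → List (Fin N)
  window ks a = List.map (λ k → prev^ k a) ks

  ∑-count-window : ∀ (S : Subset N) ks →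
    ∑[ a < N ] count S (window ks a) ≡ length ks * ∣ S ∣
  ∑-count-window S []       = sum-replicate-zero N
  ∑-count-window S (k ∷ ks) = begin
    ∑[ a < N ] count S (prev^ k a ∷ window ks a)
      ≡⟨ sum-cong-≗ (λ a → count-++ S (prev^ k a ∷ []) (window ks a)) ⟩
    ∑[ a < N ] (count S (prev^ k a ∷ []) + count S (window ks a))
      ≡⟨ ∑-distrib-+ (λ a → count S (prev^ k a ∷ [])) (λ a → count S (window ks a)) ⟩
    ∑[ a < N ] count S (prev^ k a ∷ []) + ∑[ a < N ] count S (window ks a)
      ≡⟨ cong (_+ ∑[ a < N ] count S (window ks a)) (∑-prev^ k (λ a → count S (a ∷ []))) ⟩
    ∑[ a < N ] count S (a ∷ []) + ∑[ a < N ] count S (window ks a)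
      ≡⟨ cong₂ _+_ (sym (∣p∣≡∑count S)) (∑-count-window S ks) ⟩
    ∣ S ∣ + length ks * ∣ S ∣
      ∎
    where open ≡-Reasoning

  double-counting : ∀ (S : Subset N) ks c →
    (∀ a → c ≤ count S (window ks a)) → N * c ≤ length ks * ∣ S ∣
  double-counting S ks c c≤ = ≤-trans (∑-≥ c c≤) (≤-reflexive (∑-count-window S ks))

  alternating-meets-edges : ∀ u → u ∈ alternating N inside ⊎ prev u ∈ alternating N inside
  alternating-meets-edges zero    = inj₁ here
  alternating-meets-edges (suc i) = alternating-consecutive inside i

  alternating-generator : IsKAdjGenerator 2 G (alternating N inside)
  alternating-generator = generator-criterion 2 S
    (λ a → count-++-mono (pair a) (pair (prev^ 2 a)) (on-pair a) (on-pair (prev^ 2 a)))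
    (λ a → count-++-mono (pair a) (pair (prev^ 3 a)) (on-pair a) (on-pair (prev^ 3 a)))
    (λ a b → count-++-mono (triple a) (triple b) (on-triple a) (on-triple b))
    where
    S = alternating N inside
    on-pair : ∀ u → 1 ≤ count S (pair u)
    on-pair u = count-pair (alternating-meets-edges u)
    on-triple : ∀ u → 1 ≤ count S (triple u)
    on-triple u = ≤-trans (on-pair (prev u)) (count-∷ S u (pair (prev u)))

  adim₂ : AdimIs 2 G ⌈ N /2⌉
  adim₂ = (alternating N inside , alternating-generator , proj₁ (∣alternating∣ N))
        , λ S gen → ⌈n/2⌉≤ {N}
            (double-counting S (0 ∷ 1 ∷ 2 ∷ 3 ∷ []) 2 (generator-on-span₁ gen))

  everyFifth-sparse : ∀ k u → 0 < k → k < 5 → u ∈ everyFifth N → prev^ k u ∉ everyFifth N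
  everyFifth-sparse k u 0<k k<5 u∈ v∈
    with everyFifth-∈ N u∈ | everyFifth-∈ N v∈ | toℕ-prev^ k u (≤-trans k<5 (s≤s 4≤m))
  ... | 5∣u , _ | 5∣v , _ | inj₁ e =
    <⇒≱ k<5 (∣⇒≤ {{>-nonZero 0<k}} (∣m+n∣m⇒∣n (subst (5 ∣_) (sym e) 5∣u) 5∣v))
  ... | _ | _ , v+5≤N | inj₂ e =
    <⇒≱ (≤-trans (+-monoʳ-< (toℕ (prev^ k u)) k<5) v+5≤N)
        (subst (N ≤_) (sym e) (m≤n+m N (toℕ u)))

  ∁everyFifth-near : Near (λ u v → u ∈ ∁ (everyFifth N) ⊎ v ∈ ∁ (everyFifth N))
  ∁everyFifth-near k u {1≤k} {k≤4} with u ∈? everyFifth N | prev^ k u ∈? everyFifth N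
  ... | no u∉  | _      = inj₁ (x∉p⇒x∈∁p u∉)
  ... | yes _  | no v∉  = inj₂ (x∉p⇒x∈∁p v∉)
  ... | yes u∈ | yes v∈ =
    ⊥-elim (everyFifth-sparse k u (toWitness 1≤k) (s≤s (toWitness k≤4)) u∈ v∈)

  ∁everyFifth-generator : IsKAdjGenerator 3 G (∁ (everyFifth N))
  ∁everyFifth-generator = generator-criterion 3 S
    (λ a → ≤-pred (count-AllPairs (span₁-AllPairs ∁everyFifth-near a)))
    (λ a → ≤-pred (count-AllPairs (span₂-AllPairs ∁everyFifth-near a)))
    (λ a b → ≤-trans (n≤1+n 3) (count-++-mono (triple a) (triple b) (on-triple a) (on-triple b)))
    where
    S = ∁ (everyFifth N)
    on-triple : ∀ u → 2 ≤ count S (triple u)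
    on-triple u = ≤-pred (count-AllPairs (triple-AllPairs ∁everyFifth-near u))

  -- If a ∉ S, the first and third windows put all of prev a, …, prev⁴ a in S.
  four-of-five : ∀ {S} a →
    3 ≤ count S (span₁ a) → 3 ≤ count S (span₁ (prev a)) → 3 ≤ count S (span₂ a) →
    4 ≤ count S (window (0 ∷ 1 ∷ 2 ∷ 3 ∷ 4 ∷ []) a)
  four-of-five {S} a on₁ on₁′ on₂ = by-cases (a ∈? S)
    where
    by-cases : Dec (a ∈ S) → 4 ≤ count S (a ∷ span₁ (prev a))
    by-cases (yes a∈S) = ≤-trans (s≤s on₁′) (≤-reflexive (sym (count-∈ a∈S)))
    by-cases (no a∉S)  = ≤-reflexive (sym (trans (count-∉ a∉S) (count-all rest⊆S)))
      where
      rest⊆S : All (_∈ S) (span₁ (prev a))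
      rest⊆S with count-full S (prev a ∷ prev^ 2 a ∷ prev^ 3 a ∷ []) (subst (3 ≤_) (count-∉ a∉S) on₁)
                | count-full S (prev a ∷ prev^ 3 a ∷ prev^ 4 a ∷ []) (subst (3 ≤_) (count-∉ a∉S) on₂)
      ... | π¹ ∷ π² ∷ π³ ∷ [] | _ ∷ _ ∷ π⁴ ∷ [] = π¹ ∷ π² ∷ π³ ∷ π⁴ ∷ []

  adim₃ : AdimIs 3 G (N ∸ N / 5)
  adim₃ = (∁ (everyFifth N) , ∁everyFifth-generator , ∣∁everyFifth∣)
        , λ S gen → n∸n/5≤ {N} (double-counting S (0 ∷ 1 ∷ 2 ∷ 3 ∷ 4 ∷ []) 4 λ a →
            four-of-five a (generator-on-span₁ gen a) (generator-on-span₁ gen (prev a))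
                           (generator-on-span₂ gen a))
    where
    ∣∁everyFifth∣ = trans (∣∁p∣≡n∸∣p∣ (everyFifth N)) (cong (N ∸_) (∣everyFifth∣ N))

  ⊤-generator : IsKAdjGenerator 4 G ⊤
  ⊤-generator = generator-criterion 4 ⊤
    (λ a → ≤-reflexive (sym (count-⊤ (span₁ a))))
    (λ a → ≤-reflexive (sym (count-⊤ (span₂ a))))
    (λ a b → ≤-trans (m≤m+n 4 2) (≤-reflexive (sym (count-⊤ (triple a ++ triple b)))))

  adim₄ : AdimIs 4 G N
  adim₄ = (⊤ , ⊤-generator , ∣⊤∣≡n N)
        , λ S gen → subst (_≤ ∣ S ∣) (∣⊤∣≡n N)
            (p⊆q⇒∣p∣≤∣q∣ {p = ⊤} λ {u} _ → All.head (count-full S (span₁ u) (generator-on-span₁ gen u)))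

proposition33 : ∀ (n : ℕ) → 5 ≤ n →
    AdimIs 2 (cycle n) ((n + 1) / 2)
    × AdimIs 3 (cycle n) (n ∸ n / 5)
    × AdimIs 4 (cycle n) n
proposition33 (suc m) (s≤s 4≤m) = subst (AdimIs 2 G) (⌈n/2⌉≡[n+1]/2 N) adim₂ , adim₃ , adim₄
  where open Cycle m 4≤m
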